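{- Let $d\ge1$, $r\ge0$. For every balanced shifted tableau $B$ of shape $Z(d,r)$ and every $1\le i\le d$, $B(i,0)<B(i,1)<B(i,2)<\cdots<B(i,r)$.
   Context: The trapezoid $Z(d,r)$ is the strict partition $(r+2d-1,r+2d-3,\dots,r+3,r+1)$ with $d$ parts. For a strict partition $\lambda=(\lambda_1>\cdots>\lambda_d>0)$ the shifted diagram is $D(\lambda)=\{(i,j-d+i-1):1\le i\le d,1\le j\le\lambda_i\}$ (row $i$ occupies columns $i-d,\dots,\lambda_i-d+i-1$); for $Z(d,r)$ row $i$ occupies columns $i-d,\dots,r+d-i$. $B(i,j)$ is the entry in box $(i,j)$. For $(i,j)\in D(\lambda)$ with $j\ge0$ the hook $H(i,j)$ is $(i,j)$ with the boxes of row $i$ to its right and of column $j$ below it; for $(i,-j)$, $j>0$, $H(i,-j)$ is $(i,-j)$, the boxes of row $i$ to its right, the boxes of column $-j$ below it, and all boxes of row $d-j+1$. The extended filling $\tilde B$ additionally puts $B(i,0)$ in the box $(i,-(d+1-i))$, $1\le i\le d$. Extended hook: $\tilde H(i,j)=H(i,j)$ for $j\ge0$, $\tilde H(i,-j)=H(i,-j)\cup\{(d+1-j,-j)\}$ for $j>0$. Rank: $\mathrm{rk}(i,j)=\lambda_i-d+i-j$ if $j\ge0$, $\lambda_i-d+i+\lambda_{d+1+j}+j+1$ if $j<0$. $B$ is a balanced shifted tableau of shape $\lambda$ if it uses each of $1,\dots,|\lambda|$ once and for every $(i,j)\in D(\lambda)$ exactly $\mathrm{rk}(i,j)-1$ boxes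 of $\tilde H(i,j)$ carry an entry of $\tilde B$ larger than $B(i,j)$. -}

module Defs where

open import Data.Nat as ℕ using (ℕ; zero; suc; _≤_; _<_; _∸_)
open import Data.Integer as ℤ using (ℤ; +_; -[1+_])
open import Data.Bool using (Bool; true; false; _∧_; _∨_; if_then_else_)
open import Data.List using (List; []; _∷_; map; upTo; concatMap; filterᵇ; length)
open import Data.List.Membership.Propositional using (_∈_)
open import Data.Product using (_×_; _,_; Σ; ∃; proj₁; proj₂)
open import Relation.Binary.PropositionalEquality using (_≡_)
open import Relation.Nullary.Decidable using (⌊_⌋)

-- A box is (row i, column j); rows are 1-indexed naturals, columns integers.
Box : Set
Box = ℕ × ℤ

-- A (shape) is given by d and p : ℕ → ℕ, where p i is the i-th part, 1 ≤ i ≤ d.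

rowBoxes : ℕ → (ℕ → ℕ) → ℕ → List Box
rowBoxes d p i = map (λ k → (i , (+ i ℤ.- + d) ℤ.+ + k)) (upTo (p i))

cells : ℕ → (ℕ → ℕ) → List Box
cells d p = concatMap (rowBoxes d p) (map suc (upTo d))

size : ℕ → (ℕ → ℕ) → ℕ
size d p = length (cells d p)

Z : ℕ → ℕ → (ℕ → ℕ)
Z d r i = r ℕ.+ suc (2 ℕ.* d) ∸ 2 ℕ.* i

-- A filling assigns a natural number to every box (only boxes of D(λ) matter).
Filling : Set
Filling = ℕ → ℤ → ℕ

-- Row index d+1+j for a negative column j = -[1+ m ], i.e. d - m.
-- Membership (as a Bool) of box (i' , j') of D(λ) in the (non-extended) hook H(i,j).
inHook : ℕ → ℕ → ℤ → Box → Bool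
inHook d i j (i' , j') =
  (( ⌊ i' ℕ.≟ i ⌋ ∧ (j ℤ.≤ᵇ j')) ∨ (⌊ j' ℤ.≟ j ⌋ ∧ (i ℕ.<ᵇ i')))
  ∨ extra j
  where
  extra : ℤ → Bool
  extra (+ _)      = false
  extra -[1+ m ]   = ⌊ i' ℕ.≟ d ∸ m ⌋

-- Number of boxes of the extended hook H~(i,j) carrying an entry of the
-- extended filling B~ larger than B(i,j).
largerInHook : ℕ → (ℕ → ℕ) → Filling → ℕ → ℤ → ℕ
largerInHook d p B i j =
  length (filterᵇ (λ b → inHook d i j b ∧ (B i j ℕ.<ᵇ B (proj₁ b) (proj₂ b)))
                 (cells d p))
  ℕ.+ extBox j
  where
  -- the extra box (d+1+j , j) of the extended hook, for j < 0, carries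
  -- B~(d+1+j , j) = B(d+1+j , 0)
  extBox : ℤ → ℕ
  extBox (+ _)    = 0
  extBox -[1+ m ] = if B i j ℕ.<ᵇ B (d ∸ m) (+ 0) then 1 else 0

rk : ℕ → (ℕ → ℕ) → ℕ → ℤ → ℤ
rk d p i (+ n)      = + p i ℤ.- + d ℤ.+ + i ℤ.- + n
rk d p i j@(-[1+ m ]) = + p i ℤ.- + d ℤ.+ + i ℤ.+ + p (d ∸ m) ℤ.+ j ℤ.+ ℤ.1ℤ

record Balanced (d : ℕ) (p : ℕ → ℕ) (B : Filling) : Set where
  field
    range     : ∀ {i j} → (i , j) ∈ cells d p → 1 ≤ B i j × B i j ≤ size d p
    injective : ∀ {i j i' j'} → (i , j) ∈ cells d p → (i' , j') ∈ cells d p →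
                B i j ≡ B i' j' → (i , j) ≡ (i' , j')
    surjective : ∀ k → 1 ≤ k → k ≤ size d p →
                 ∃ λ (b : Box) → b ∈ cells d p × B (proj₁ b) (proj₂ b) ≡ k
    hookCond  : ∀ {i j} → (i , j) ∈ cells d p →
                + largerInHook d p B i j ≡ rk d p i j ℤ.- ℤ.1ℤ

module Submission where

open import Defs
open import Data.Nat using (ℕ; suc; _≤_; _<_)
open import Data.Integer using (+_)

open import Data.Nat using (zero; _≟_; _<ᵇ_; _+_; _*_; _∸_; pred; z≤n; s≤s)
open import Data.Nat.Properties
  using (≤-refl; ≤-trans; ≤-pred; <-irrefl; <-trans; <-≤-trans; <⇒≱; <-cmp; 1+n≰n;
         m≤n⇒m≤1+n; m≤m+n; +-mono-≤; +-monoˡ-≤; +-monoʳ-≤; +-suc; +-assoc; <⇒≤; 1+n≢n;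
         m+[n∸m]≡n; m+n≤o⇒m≤o∸n; <ᵇ⇒<; <⇒<ᵇ; module ≤-Reasoning)
import Data.Nat.Tactic.RingSolver as ℕ-Solver
open import Data.Integer as ℤ using (ℤ; 1ℤ)
import Data.Integer.Properties as ℤP
import Data.Integer.Tactic.RingSolver as ℤ-Solver
open import Data.Bool using (Bool; true; false; T; _∧_)
open import Data.Bool.Properties using (T?; T-≡; T-∧)
open import Data.List using (List; []; _∷_; _++_; map; applyUpTo; upTo; concatMap; filterᵇ; length)
open import Data.List.Properties using (filter-++; length-++)
open import Data.List.Membership.Propositional using (_∈_; lose)
open import Data.List.Membership.Propositional.Properties
  using (∈-map⁺; ∈-map⁻; ∈-upTo⁺; ∈-upTo⁻; ∈-concatMap⁺)
open import Data.List.Relation.Unary.Any using (here; there)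
open import Data.Product using (_×_; _,_; proj₁; proj₂; map₁)
open import Data.Sum using (_⊎_; inj₁; inj₂)
open import Data.Empty using (⊥-elim)
open import Function using (_∘_; id)
open import Function.Bundles using (module Equivalence)
open Equivalence using (to; from)
open import Relation.Nullary using (¬_; yes; no; contradiction)
open import Relation.Nullary.Decidable using (⌊_⌋)
open import Relation.Binary using (Tri; tri<; tri≈; tri>)
open import Relation.Binary.PropositionalEquality

-- Since rk(i,k+1) = rk(i,k) − 1 for k ≥ 0, balance says that H(i,k) holds exactly one
-- more entry larger than B(i,k) than H(i,k+1) holds entries larger than B(i,k+1).
-- Proceed by downward induction on the row i. If B(i,k+1) < B(i,k), every box of
-- H(i,k) larger than B(i,k) gives a distinct box of H(i,k+1) larger than B(i,k+1):
-- a box (i,j) with j > k gives itself, and a box (i',k) below gives (i',k+1), which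
-- is larger still because row i' increases by induction. So H(i,k) would hold at most
-- as many larger entries, a contradiction; B(i,k) = B(i,k+1) is excluded by injectivity.

count : {A : Set} → (A → Bool) → List A → ℕ
count P xs = length (filterᵇ P xs)

module _ {A : Set} where

  count-++ : (P : A → Bool) (xs ys : List A) → count P (xs ++ ys) ≡ count P xs + count P ys
  count-++ P xs ys = trans (cong length (filter-++ (T? ∘ P) xs ys)) (length-++ (filterᵇ P xs))

  count-mono : (P Q : A → Bool) → (∀ {x} → T (P x) → T (Q x)) →
               (xs : List A) → count P xs ≤ count Q xs
  count-mono P Q P⇒Q [] = z≤n
  count-mono P Q P⇒Q (x ∷ xs) with P x | Q x | P⇒Q {x}
  ... | true  | true  | _   = s≤s (count-mono P Q P⇒Q xs)
  ... | true  | false | p⇒q = ⊥-elim (p⇒q _)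
  ... | false | true  | _   = m≤n⇒m≤1+n (count-mono P Q P⇒Q xs)
  ... | false | false | _   = count-mono P Q P⇒Q xs

  count-concatMap-mono : (P Q : A → Bool) {X : Set} (f : X → List A) (xs : List X) →
                         (∀ {x} → x ∈ xs → count P (f x) ≤ count Q (f x)) →
                         count P (concatMap f xs) ≤ count Q (concatMap f xs)
  count-concatMap-mono P Q f [] _ = z≤n
  count-concatMap-mono P Q f (x ∷ xs) le
    rewrite count-++ P (f x) (concatMap f xs) | count-++ Q (f x) (concatMap f xs) =
    +-mono-≤ (le (here refl)) (count-concatMap-mono P Q f xs (le ∘ there))

  count-map : (P : A → Bool) {X : Set} (f : X → A) (xs : List X) →
              count P (map f xs) ≡ count (P ∘ f) xs
  count-map P f [] = refl
  count-map P f (x ∷ xs) with P (f x)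
  ... | true  = cong suc (count-map P f xs)
  ... | false = count-map P f xs

count-shift : (P Q : ℕ → Bool) (n : ℕ) →
              (∀ {t} → T (P t) → suc t < n × T (Q (suc t))) →
              count P (upTo n) ≤ count Q (upTo n)
count-shift P Q n shift = ≤-trans (shifted n id shift) (dropHead n id)
  where
  shifted : ∀ n f → (∀ {t} → T (P (f t)) → suc t < n × T (Q (f (suc t)))) →
            count P (applyUpTo f n) ≤ count Q (applyUpTo (f ∘ suc) (pred n))
  shifted zero f _ = z≤n
  shifted (suc zero) f shift with P (f 0) | shift {0}
  ... | true  | s = ⊥-elim (<-irrefl refl (proj₁ (s _)))
  ... | false | _ = z≤n
  shifted (suc (suc n)) f shift
    with P (f 0) | Q (f 1) | shift {0} | shifted (suc n) (f ∘ suc) (map₁ ≤-pred ∘ shift)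
  ... | true  | true  | _ | ih = s≤s ih
  ... | true  | false | s | _  = ⊥-elim (proj₂ (s _))
  ... | false | true  | _ | ih = m≤n⇒m≤1+n ih
  ... | false | false | _ | ih = ih

  dropHead : ∀ n f → count Q (applyUpTo (f ∘ suc) (pred n)) ≤ count Q (applyUpTo f n)
  dropHead zero f = z≤n
  dropHead (suc n) f with Q (f 0)
  ... | true  = m≤n⇒m≤1+n ≤-refl
  ... | false = ≤-refl

column : ℕ → ℕ → ℕ → ℤ
column d i t = (+ i ℤ.- + d) ℤ.+ + t

column-suc : ∀ d i t → column d i (suc t) ≡ ℤ.suc (column d i t)
column-suc d i t = shift-one (+ i ℤ.- + d) (+ t)
  where
  shift-one : ∀ a b → a ℤ.+ (1ℤ ℤ.+ b) ≡ 1ℤ ℤ.+ (a ℤ.+ b)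
  shift-one = ℤ-Solver.solve-∀

column≡+⇒ : ∀ {d i t k} → column d i t ≡ + k → i + t ≡ d + k
column≡+⇒ {d} {i} {t} {k} eq = ℤP.+-injective (begin
  + i ℤ.+ + t                     ≡⟨ move (+ i) (+ d) (+ t) ⟩
  column d i t ℤ.+ + d            ≡⟨ cong (ℤ._+ + d) eq ⟩
  + k ℤ.+ + d                     ≡⟨ ℤP.+-comm (+ k) (+ d) ⟩
  + d ℤ.+ + k                     ∎)
  where
  open ≡-Reasoning
  move : ∀ a b c → a ℤ.+ c ≡ ((a ℤ.- b) ℤ.+ c) ℤ.+ b
  move = ℤ-Solver.solve-∀

column≡+⇐ : ∀ {d i t k} → i + t ≡ d + k → column d i t ≡ + k
column≡+⇐ {d} {i} {t} {k} eq = begin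
  column d i t                    ≡⟨ move (+ i) (+ d) (+ t) ⟩
  (+ i ℤ.+ + t) ℤ.- + d           ≡⟨ cong (λ n → + n ℤ.- + d) eq ⟩
  (+ d ℤ.+ + k) ℤ.- + d           ≡⟨ cancel (+ d) (+ k) ⟩
  + k                             ∎
  where
  open ≡-Reasoning
  move : ∀ a b c → (a ℤ.- b) ℤ.+ c ≡ (a ℤ.+ c) ℤ.- b
  move = ℤ-Solver.solve-∀
  cancel : ∀ a b → (a ℤ.+ b) ℤ.- a ≡ b
  cancel = ℤ-Solver.solve-∀

∈-cells : ∀ {d p i t} → 1 ≤ i → i ≤ d → t < p i → (i , column d i t) ∈ cells d p
∈-cells {d} {p} {suc i} _ i≤d t<p =
  ∈-concatMap⁺ (rowBoxes d p)
    (lose (∈-map⁺ suc (∈-upTo⁺ i≤d))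
          (∈-map⁺ (λ t → (suc i , column d (suc i) t)) (∈-upTo⁺ t<p)))

-- Row i of Z(d,r) reaches column r + d − i ≥ r.
Z-row-bound : ∀ {d r i t k} → i ≤ d → i + t ≡ d + k → k ≤ r → t < Z d r i
Z-row-bound {d} {r} {i} {t} {k} i≤d eq k≤r = m+n≤o⇒m≤o∸n (suc t) (begin
  suc t + 2 * i         ≡⟨ regroup t i ⟩
  suc (i + t + i)       ≡⟨ cong (λ n → suc (n + i)) eq ⟩
  suc (d + k + i)       ≤⟨ s≤s (+-mono-≤ (+-monoʳ-≤ d k≤r) i≤d) ⟩
  suc (d + r + d)       ≡⟨ regroup′ d r ⟩
  r + suc (2 * d)       ∎)
  where
  open ≤-Reasoning
  regroup : ∀ t i → suc t + 2 * i ≡ suc (i + t + i)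
  regroup = ℕ-Solver.solve-∀
  regroup′ : ∀ d r → suc (d + r + d) ≡ r + suc (2 * d)
  regroup′ = ℕ-Solver.solve-∀

∈-Z : ∀ {d r i k} → 1 ≤ i → i ≤ d → k ≤ r → (i , + k) ∈ cells d (Z d r)
∈-Z {d} {r} {i} {k} 1≤i i≤d k≤r =
  subst (λ j → (i , j) ∈ cells d (Z d r)) (column≡+⇐ offset)
        (∈-cells 1≤i i≤d (Z-row-bound i≤d offset k≤r))
  where
  offset : i + (d ∸ i + k) ≡ d + k
  offset = trans (sym (+-assoc i (d ∸ i) k)) (cong (_+ k) (m+[n∸m]≡n i≤d))

rk-pred : ∀ d p i k → rk d p i (+ k) ℤ.- 1ℤ ≡ ℤ.suc (rk d p i (+ suc k) ℤ.- 1ℤ)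
rk-pred d p i k = step (+ p i ℤ.- + d ℤ.+ + i) (+ k)
  where
  step : ∀ a b → a ℤ.- b ℤ.- 1ℤ ≡ 1ℤ ℤ.+ (a ℤ.- (1ℤ ℤ.+ b) ℤ.- 1ℤ)
  step = ℤ-Solver.solve-∀

largerInHook-suc : ∀ {d p B i k} → Balanced d p B →
                   (i , + k) ∈ cells d p → (i , + suc k) ∈ cells d p →
                   largerInHook d p B i (+ k) ≡ suc (largerInHook d p B i (+ suc k))
largerInHook-suc {d} {p} {B} {i} {k} bal ik∈ ik+1∈ = ℤP.+-injective (begin
  + largerInHook d p B i (+ k)                  ≡⟨ hookCond ik∈ ⟩
  rk d p i (+ k) ℤ.- 1ℤ                          ≡⟨ rk-pred d p i k ⟩
  ℤ.suc (rk d p i (+ suc k) ℤ.- 1ℤ)              ≡⟨ cong ℤ.suc (hookCond ik+1∈) ⟨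
  ℤ.suc (+ largerInHook d p B i (+ suc k))      ∎)
  where
  open ≡-Reasoning
  open Balanced bal

inHook-row : ∀ d i k j → + k ℤ.≤ j → T (inHook d i (+ k) (i , j))
inHook-row d i k j k≤j with i ≟ i | + k ℤ.≤ᵇ j | ℤP.≤⇒≤ᵇ k≤j
... | yes _   | true | _ = _
... | no i≢i  | _    | _ = contradiction refl i≢i

-- The row disjunct is abstracted only so that the disjunction computes.
inHook-column : ∀ d i k i′ → i < i′ → T (inHook d i (+ k) (i′ , + k))
inHook-column d i k i′ i<i′
  with + k ℤ.≟ + k | i <ᵇ i′ | <⇒<ᵇ i<i′ | ⌊ i′ ≟ i ⌋ ∧ (+ k ℤ.≤ᵇ + k)
... | yes _  | true | _ | true  = _
... | yes _  | true | _ | false = _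
... | no k≢k | _    | _ | _     = contradiction refl k≢k

inHook⁻ : ∀ d i k i′ j → T (inHook d i (+ k) (i′ , j)) →
          (i′ ≡ i × + k ℤ.≤ j) ⊎ (j ≡ + k × i < i′)
inHook⁻ d i k i′ j h with i′ ≟ i | + k ℤ.≤ᵇ j in k≤j | j ℤ.≟ + k | i <ᵇ i′ in i<i′
... | yes e | true  | _     | _     = inj₁ (e , ℤP.≤ᵇ⇒≤ (T-≡ .from k≤j))
... | _     | _     | yes e | true  = inj₂ (e , <ᵇ⇒< i i′ (T-≡ .from i<i′))
... | yes _ | false | no _  | _     = ⊥-elim h
... | yes _ | false | yes _ | false = ⊥-elim h
... | no _  | _     | no _  | _     = ⊥-elim h
... | no _  | _     | yes _ | false = ⊥-elim h

module _ (d : ℕ) (B : Filling) where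

  -- For k ≥ 0, largerInHook d p B i (+ k) is definitionally count (exceedsInHook i k) (cells d p) + 0.
  exceedsInHook : ℕ → ℕ → Box → Bool
  exceedsInHook i k b = inHook d i (+ k) b ∧ (B i (+ k) <ᵇ B (proj₁ b) (proj₂ b))

  exceedsInHook-row⁺ : ∀ {i k j} → + k ℤ.≤ j → B i (+ k) < B i j →
                       T (exceedsInHook i k (i , j))
  exceedsInHook-row⁺ {i} {k} {j} k≤j gt =
    T-∧ {inHook d i (+ k) (i , j)} {B i (+ k) <ᵇ B i j} .from (inHook-row d i k j k≤j , <⇒<ᵇ gt)

  exceedsInHook-column⁺ : ∀ {i k i′} → i < i′ → B i (+ k) < B i′ (+ k) →
                          T (exceedsInHook i k (i′ , + k))
  exceedsInHook-column⁺ {i} {k} {i′} i<i′ gt =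
    T-∧ {inHook d i (+ k) (i′ , + k)} {B i (+ k) <ᵇ B i′ (+ k)} .from
      (inHook-column d i k i′ i<i′ , <⇒<ᵇ gt)

  exceedsInHook-row⁻ : ∀ {i k i′ j} → ¬ i < i′ → T (exceedsInHook i k (i′ , j)) →
                       i′ ≡ i × + suc k ℤ.≤ j × B i (+ k) < B i j
  exceedsInHook-row⁻ {i} {k} {i′} {j} i≮i′ h
    with T-∧ {inHook d i (+ k) (i′ , j)} {B i (+ k) <ᵇ B i′ j} .to h
  ... | inH , gt with inHook⁻ d i k i′ j inH
  ... | inj₂ (_ , i<i′) = contradiction i<i′ i≮i′
  ... | inj₁ (refl , k≤j) = refl , ℤP.i<j⇒suc[i]≤j (ℤP.≤∧≢⇒< k≤j k≢j) , gt′
    where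
    gt′ : B i (+ k) < B i j
    gt′ = <ᵇ⇒< _ _ gt
    k≢j : + k ≢ j
    k≢j refl = <-irrefl refl gt′

  exceedsInHook-column⁻ : ∀ {i k i′ j} → i < i′ → T (exceedsInHook i k (i′ , j)) →
                          j ≡ + k × B i (+ k) < B i′ (+ k)
  exceedsInHook-column⁻ {i} {k} {i′} {j} i<i′ h
    with T-∧ {inHook d i (+ k) (i′ , j)} {B i (+ k) <ᵇ B i′ j} .to h
  ... | inH , gt with inHook⁻ d i k i′ j inH
  ... | inj₁ (refl , _) = contradiction i<i′ (<-irrefl refl)
  ... | inj₂ (refl , _) = refl , <ᵇ⇒< _ _ gt

module ColumnPair (d r : ℕ) (B : Filling) (bal : Balanced d (Z d r) B)
                  (k : ℕ) (k<r : k < r) where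
  open Balanced bal

  Increasing : ℕ → Set
  Increasing i = B i (+ k) < B i (+ suc k)

  IncreasingBelow : ℕ → Set
  IncreasingBelow i = ∀ {i′} → i < i′ → i′ ≤ d → Increasing i′

  module _ {i : ℕ} (descent : B i (+ suc k) < B i (+ k)) (below : IncreasingBelow i) where

    E : ℕ → Box → Bool
    E = exceedsInHook d B i

    row-count-mono : ∀ {i′} → i′ ≤ d →
                     count (E k) (rowBoxes d (Z d r) i′) ≤ count (E (suc k)) (rowBoxes d (Z d r) i′)
    row-count-mono {i′} i′≤d = begin
      count (E k) (map box (upTo n))        ≡⟨ count-map (E k) box (upTo n) ⟩
      count (E k ∘ box) (upTo n)            ≤⟨ byPosition (<-cmp i i′) ⟩
      count (E (suc k) ∘ box) (upTo n)      ≡⟨ count-map (E (suc k)) box (upTo n) ⟨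
      count (E (suc k)) (map box (upTo n))  ∎
      where
      open ≤-Reasoning
      n : ℕ
      n = Z d r i′
      box : ℕ → Box
      box t = (i′ , column d i′ t)

      stay : ¬ i < i′ → ∀ {t} → T (E k (box t)) → T (E (suc k) (box t))
      stay i≮i′ h with exceedsInHook-row⁻ d B i≮i′ h
      ... | refl , k<j , gt = exceedsInHook-row⁺ d B k<j (<-trans descent gt)

      shift : i < i′ → ∀ {t} → T (E k (box t)) → suc t < n × T (E (suc k) (box (suc t)))
      shift i<i′ {t} h with exceedsInHook-column⁻ d B i<i′ h
      ... | onColumn , gt =
        Z-row-bound i′≤d (column≡+⇒ nextColumn) k<r ,
        subst (λ j → T (E (suc k) (i′ , j))) (sym nextColumn)
          (exceedsInHook-column⁺ d B i<i′ (<-trans descent (<-trans gt (below i<i′ i′≤d))))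
        where
        nextColumn : column d i′ (suc t) ≡ + suc k
        nextColumn = trans (column-suc d i′ t) (cong ℤ.suc onColumn)

      byPosition : Tri (i < i′) (i ≡ i′) (i′ < i) →
                   count (E k ∘ box) (upTo n) ≤ count (E (suc k) ∘ box) (upTo n)
      byPosition (tri< i<i′ _ _) = count-shift (E k ∘ box) (E (suc k) ∘ box) n (shift i<i′)
      byPosition (tri≈ i≮i′ _ _) = count-mono (E k ∘ box) (E (suc k) ∘ box) (stay i≮i′) (upTo n)
      byPosition (tri> i≮i′ _ _) = count-mono (E k ∘ box) (E (suc k) ∘ box) (stay i≮i′) (upTo n)

    largerInHook-mono : largerInHook d (Z d r) B i (+ k) ≤ largerInHook d (Z d r) B i (+ suc k)
    largerInHook-mono =
      +-monoˡ-≤ 0 (count-concatMap-mono (E k) (E (suc k)) (rowBoxes d (Z d r)) (map suc (upTo d))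
                    (row-count-mono ∘ row≤d))
      where
      row≤d : ∀ {i′} → i′ ∈ map suc (upTo d) → i′ ≤ d
      row≤d i′∈ with ∈-map⁻ suc i′∈
      ... | _ , i₀∈ , refl = ∈-upTo⁻ i₀∈

  increasing-step : ∀ {i} → 1 ≤ i → i ≤ d → IncreasingBelow i → Increasing i
  increasing-step {i} 1≤i i≤d below = byComparison (<-cmp (B i (+ k)) (B i (+ suc k)))
    where
    ik∈ : (i , + k) ∈ cells d (Z d r)
    ik∈ = ∈-Z 1≤i i≤d (<⇒≤ k<r)
    ik+1∈ : (i , + suc k) ∈ cells d (Z d r)
    ik+1∈ = ∈-Z 1≤i i≤d k<r

    byComparison : Tri (Increasing i) (B i (+ k) ≡ B i (+ suc k)) (B i (+ suc k) < B i (+ k)) →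
                   Increasing i
    byComparison (tri< increasing _ _) = increasing
    byComparison (tri≈ _ eq _) =
      contradiction (ℤP.+-injective (cong proj₂ (injective ik∈ ik+1∈ eq))) (1+n≢n ∘ sym)
    byComparison (tri> _ _ descent) =
      contradiction (subst (_≤ largerInHook d (Z d r) B i (+ suc k))
                           (largerInHook-suc bal ik∈ ik+1∈)
                           (largerInHook-mono descent below))
                    1+n≰n

  rows-increasing : ∀ m {i} → d ≤ m + i → 1 ≤ i → i ≤ d → Increasing i
  rows-increasing zero d≤i 1≤i i≤d =
    increasing-step 1≤i i≤d (λ i<i′ i′≤d → contradiction d≤i (<⇒≱ (<-≤-trans i<i′ i′≤d)))
  rows-increasing (suc m) {i} d≤1+m+i 1≤i i≤d =
    increasing-step 1≤i i≤d (λ {i′} i<i′ i′≤d →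
      rows-increasing m (≤-trans d≤1+m+i (subst (_≤ m + i′) (+-suc m i) (+-monoʳ-≤ m i<i′)))
                      (≤-trans 1≤i (<⇒≤ i<i′)) i′≤d)

corollary3p5 : (d r : ℕ) → 1 ≤ d → (B : Filling) → Balanced d (Z d r) B →
    (i : ℕ) → 1 ≤ i → i ≤ d → (k : ℕ) → k < r → B i (+ k) < B i (+ suc k)
corollary3p5 d r _ B bal i 1≤i i≤d k k<r =
  ColumnPair.rows-increasing d r B bal k k<r d (m≤m+n d i) 1≤i i≤d
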